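{- Let $(T,<_0,\dots,<_{n-1})$ be a hereditarily linear $J_n$-frame. Then for all $x,y\in T$ with $x\ne y$ there is exactly one $k<n$ such that $x<_k y$ or $y<_k x$; and for this $k$, exactly one of $x<_k y$, $y<_k x$ holds.
   Context: A $J_n$-frame is a structure $(T,<_0,\dots,<_{n-1})$ where each $<_i$ is an irreflexive, transitive, converse well-founded binary relation on $T$, and for all $k<m<n$: (1) if $x<_m y<_k z$ then $x<_k z$; (2) if $x<_k y<_m z$ then $x<_k z$; (3) if $x<_k z$ and $y<_m z$ then $x<_k y$. A $J_n$-frame is hereditarily linear if for all distinct $x,y\in T$ there is $k<n$ with $x<_k y$ or $y<_k x$. -}

module Defs where

open import Level using (Level; _⊔_; suc)
open import Data.Nat using (ℕ)
open import Data.Fin using (Fin; _<_)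
open import Data.Product using (_×_; ∃; Σ-syntax; ∃-syntax)
open import Data.Sum using (_⊎_)
open import Relation.Binary.Core using (Rel)
open import Relation.Binary.Definitions using (Transitive)
open import Relation.Binary.PropositionalEquality using (_≡_)
open import Relation.Nullary using (¬_)
open import Induction.WellFounded using (WellFounded)
open import Function using (flip)

record IsJFrame {a ℓ : Level} {T : Set a} (n : ℕ) (R : Fin n → Rel T ℓ) : Set (a ⊔ ℓ) where
  field
    irrefl   : ∀ k x → ¬ R k x x
    trans    : ∀ k → Transitive (R k)
    convWF   : ∀ k → WellFounded (flip (R k))
    ax1 : ∀ {k m} → k < m → ∀ {x y z} → R m x y → R k y z → R k x z
    ax2 : ∀ {k m} → k < m → ∀ {x y z} → R k x y → R m y z → R k x z
    ax3 : ∀ {k m} → k < m → ∀ {x y z} → R k x z → R m y z → R k x y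

HereditarilyLinear : {a ℓ : Level} {T : Set a} (n : ℕ) (R : Fin n → Rel T ℓ) → Set (a ⊔ ℓ)
HereditarilyLinear {T = T} n R =
  ∀ (x y : T) → ¬ x ≡ y → ∃[ k ] (R k x y ⊎ R k y x)

module Submission where

open import Defs
open import Level using (Level)
open import Data.Nat using (ℕ)
open import Data.Fin using (Fin; _<_)
open import Data.Fin.Properties using (<-cmp)
open import Data.Product using (_×_; ∃-syntax; _,_)
open import Data.Sum using (_⊎_; inj₁; inj₂)
open import Relation.Binary.Core using (Rel)
open import Relation.Binary.Definitions using (tri<; tri≈; tri>)
open import Relation.Binary.PropositionalEquality using (_≡_)
open import Relation.Nullary using (¬_; contradiction)

-- Comparability of x and y at two levels k < m is refuted by irreflexivity:
-- axiom (3) (same direction) or axiom (1) (opposite directions) yields a loop at level k.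

module JFrameProperties {a ℓ : Level} {T : Set a} {n : ℕ} {R : Fin n → Rel T ℓ}
                        (J : IsJFrame n R) where
  open IsJFrame J

  Comparable : Fin n → T → T → Set ℓ
  Comparable k x y = R k x y ⊎ R k y x

  asym : ∀ k {x y} → R k x y → ¬ R k y x
  asym k {x} xy yx = irrefl k x (trans k xy yx)

  ¬comparable-at-two-levels : ∀ {k m} → k < m → ∀ {x y} →
                              Comparable k x y → ¬ Comparable m x y
  ¬comparable-at-two-levels k<m {x} {y} (inj₁ xy) (inj₁ xy′) = irrefl _ x (ax3 k<m xy xy′)
  ¬comparable-at-two-levels k<m {x} {y} (inj₁ xy) (inj₂ yx′) = irrefl _ y (ax1 k<m yx′ xy)
  ¬comparable-at-two-levels k<m {x} {y} (inj₂ yx) (inj₁ xy′) = irrefl _ x (ax1 k<m xy′ yx)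
  ¬comparable-at-two-levels k<m {x} {y} (inj₂ yx) (inj₂ yx′) = irrefl _ y (ax3 k<m yx yx′)

  comparable-level-unique : ∀ {k m x y} → Comparable k x y → Comparable m x y → m ≡ k
  comparable-level-unique {k} {m} cₖ cₘ with <-cmp m k
  ... | tri< m<k _ _ = contradiction cₖ (¬comparable-at-two-levels m<k cₘ)
  ... | tri≈ _ m≡k _ = m≡k
  ... | tri> _ _ k<m = contradiction cₘ (¬comparable-at-two-levels k<m cₖ)

lemma3p6 : {a ℓ : Level} {T : Set a} (n : ℕ) (R : Fin n → Rel T ℓ)
    → IsJFrame n R → HereditarilyLinear n R
    → ∀ (x y : T) → ¬ x ≡ y
    → ∃[ k ] ((R k x y ⊎ R k y x)
    × (∀ m → (R m x y ⊎ R m y x) → m ≡ k)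
    × ¬ (R k x y × R k y x))
lemma3p6 n R J linear x y x≢y with linear x y x≢y
... | k , cₖ = k , cₖ , (λ m cₘ → comparable-level-unique cₖ cₘ) , λ (xy , yx) → asym k xy yx
  where open JFrameProperties J
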